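{- Assume a strongly regular graph $G$ with parameters $(1911,270,105,27)$ exists and has an induced quadrangle $x\sim u\sim y\sim v\sim x$. Then there is no independent set $S$ of order $5$ in the local graph $\Delta(x)$ with $u,v\in S$.
   Context: A strongly regular graph with parameters $(n,k,\lambda,\mu)$ is a finite simple $k$-regular graph on $n$ vertices in which any two distinct adjacent vertices have exactly $\lambda$ common neighbours and any two distinct non-adjacent vertices have exactly $\mu$ common neighbours. An induced quadrangle $x\sim u\sim y\sim v\sim x$ means $x,u,y,v$ are distinct, $xu,uy,yv,vx$ are edges, and $x\not\sim y$, $u\not\sim v$. For a vertex $x$, the local graph $\Delta(x)$ is the subgraph of $G$ induced on the set of neighbours of $x$. -}

module Defs where

open import Data.Nat using (ℕ)
open import Data.Bool using (Bool; true; false; _∧_)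
open import Data.Fin using (Fin)
open import Data.List using (List; length; filterᵇ; allFin)
open import Data.Product using (_×_; ∃-syntax)
open import Relation.Binary.PropositionalEquality using (_≡_; _≢_)
open import Relation.Nullary using (¬_)

record Graph (n : ℕ) : Set where
  field
    adj     : Fin n → Fin n → Bool
    symm    : ∀ x y → adj x y ≡ adj y x
    irrefl  : ∀ x → adj x x ≡ false

module _ {n : ℕ} (G : Graph n) where
  open Graph G

  _~_ : Fin n → Fin n → Set
  x ~ y = adj x y ≡ true

  degree : Fin n → ℕ
  degree x = length (filterᵇ (adj x) (allFin n))

  common : Fin n → Fin n → ℕ
  common x y = length (filterᵇ (λ z → adj x z ∧ adj y z) (allFin n))

  IsSRG : ℕ → ℕ → ℕ → Set
  IsSRG k l m =
      (∀ x → degree x ≡ k)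
    × (∀ x y → x ≢ y → x ~ y → common x y ≡ l)
    × (∀ x y → x ≢ y → ¬ (x ~ y) → common x y ≡ m)

  InducedQuadrangle : Fin n → Fin n → Fin n → Fin n → Set
  InducedQuadrangle x u y v =
      x ≢ u × x ≢ y × x ≢ v × u ≢ y × u ≢ v × y ≢ v
    × x ~ u × u ~ y × y ~ v × v ~ x
    × ¬ (x ~ y) × ¬ (u ~ v)

  IndependentInLocal5 : Fin n → (Fin 5 → Fin n) → Set
  IndependentInLocal5 x S =
      (∀ i j → i ≢ j → S i ≢ S j)
    × (∀ i → x ~ S i)
    × (∀ i j → ¬ (S i ~ S j))

{-# OPTIONS --safe #-}
-- Double count over all vertices z, with b z the number of members of S adjacent to z:
--   Σ [x ~ z] = k,  Σ [x ~ z] b z = m λ,  Σ b z = m k,  Σ (b z)² = m (k + (m - 1) μ),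
-- the last by splitting the ordered pairs of members of S into diagonal and off-diagonal
-- ones. Every vertex satisfies 2 [x ~ z] b + b ≤ 2 [x ~ z] + b², i.e. (b - 1)(b - 2) ≥ 0
-- inside Δ(x) and b ≤ b² outside, with slack m (m - 1) at x (b = m), at least 2 at y
-- (b ≥ 2 since y ~ u, v) and 2 at each member of S (b = 0). Summing gives
--   2 m λ + 2 (m + 1) + m (m - 1) ≤ 2 k + m (m - 1) μ,
-- which is 1082 ≤ 1080 for (m, k, λ, μ) = (5, 270, 105, 27).

module Submission where

open import Defs
open import Data.Bool using (Bool; true; false; _∧_)
open import Data.Fin using (Fin; zero; suc; punchIn; punchOut)
open import Data.Fin.Properties using (_≟_; any?; punchInᵢ≢i; punchIn-punchOut)
open import Data.List using (length; filterᵇ; tabulate)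
open import Data.Nat using (ℕ; zero; suc; _+_; _*_; _∸_; _≤_; _≤?_; z≤n; s≤s)
open import Data.Nat.Properties
  using (+-*-semiring; module ≤-Reasoning; ≤-refl; ≤-reflexive; ≤-trans; +-mono-≤; +-cancelˡ-≤; m≤m+n; m≤n+m; m≤m*n; *-monoˡ-≤; *-suc; *-zeroʳ; *-identityʳ; *-identityˡ; +-identityʳ)
open import Data.Nat.Tactic.RingSolver using (solve-∀)
open import Algebra.Properties.Semiring.Sum +-*-semiring
  using (sum; sum-syntax; sum-cong-≗; sum-remove; ∑-distrib-+; ∑-comm; *-distribˡ-sum; *-distribʳ-sum)
open import Data.Empty using (⊥-elim)
open import Data.Product using (_×_; ∃-syntax; _,_; proj₁; proj₂)
open import Function using (_∘_; id)
open import Relation.Binary.PropositionalEquality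
  using (_≡_; _≢_; refl; sym; trans; cong; cong₂; subst; module ≡-Reasoning)
open import Relation.Nullary using (¬_; does; yes; no)
open import Relation.Nullary.Decidable using (dec-true; dec-false; from-no)

[_] : Bool → ℕ
[ true ]  = 1
[ false ] = 0

[]≡0 : ∀ {a} → ¬ a ≡ true → [ a ] ≡ 0
[]≡0 {true}  a≢true = ⊥-elim (a≢true refl)
[]≡0 {false} _      = refl

[∧]≡[]*[] : ∀ a b → [ a ∧ b ] ≡ [ a ] * [ b ]
[∧]≡[]*[] true  true  = refl
[∧]≡[]*[] true  false = refl
[∧]≡[]*[] false _     = refl

[]*[]≡[] : ∀ a → [ a ] * [ a ] ≡ [ a ]
[]*[]≡[] true  = refl
[]*[]≡[] false = refl

∑-const : ∀ n c → ∑[ i < n ] c ≡ n * c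
∑-const zero    c = refl
∑-const (suc n) c = cong (c +_) (∑-const n c)

∑-mono-≤ : ∀ {n} {f g : Fin n → ℕ} → (∀ i → f i ≤ g i) → sum f ≤ sum g
∑-mono-≤ {zero}  f≤g = z≤n
∑-mono-≤ {suc n} f≤g = +-mono-≤ (f≤g zero) (∑-mono-≤ (f≤g ∘ suc))

term≤∑ : ∀ {n} (f : Fin n → ℕ) i → f i ≤ sum f
term≤∑ {suc n} f i = subst (f i ≤_) (sym (sum-remove {i = i} f)) (m≤m+n _ _)

two-terms≤∑ : ∀ {n} (f : Fin n → ℕ) {i j} → i ≢ j → f i + f j ≤ sum f
two-terms≤∑ {suc n} f {i} {j} i≢j =
  subst (f i + f j ≤_) (sym (sum-remove {i = i} f))
    (+-mono-≤ ≤-refl (subst (_≤ sum (f ∘ punchIn i)) (cong f (punchIn-punchOut i≢j))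
                            (term≤∑ (f ∘ punchIn i) (punchOut i≢j))))

∑-except : ∀ {n} (f : Fin n → ℕ) i {c} → (∀ j → j ≢ i → f j ≡ c) → sum f ≡ f i + (n ∸ 1) * c
∑-except {suc n} f i {c} f≡c = begin
  sum f                       ≡⟨ sum-remove {i = i} f ⟩
  f i + sum (f ∘ punchIn i)   ≡⟨ cong (f i +_) (sum-cong-≗ (λ j → f≡c (punchIn i j) (punchInᵢ≢i i j))) ⟩
  f i + ∑[ j < n ] c          ≡⟨ cong (f i +_) (∑-const n c) ⟩
  f i + n * c                 ∎
  where open ≡-Reasoning

δ : ∀ {n} → Fin n → Fin n → ℕ
δ w z = [ does (w ≟ z) ]

δ-refl : ∀ {n} (w : Fin n) → δ w w ≡ 1
δ-refl w = cong [_] (dec-true (w ≟ w) refl)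

δ-≢ : ∀ {n} {w z : Fin n} → w ≢ z → δ w z ≡ 0
δ-≢ {w = w} {z} w≢z = cong [_] (dec-false (w ≟ z) w≢z)

∑-δ : ∀ {n} (w : Fin n) → ∑[ z < n ] δ w z ≡ 1
∑-δ {n} w = begin
  ∑[ z < n ] δ w z     ≡⟨ ∑-except (δ w) w (λ z z≢w → δ-≢ (z≢w ∘ sym)) ⟩
  δ w w + (n ∸ 1) * 0  ≡⟨ cong₂ _+_ (δ-refl w) (*-zeroʳ (n ∸ 1)) ⟩
  1                    ∎
  where open ≡-Reasoning

length-filterᵇ-tabulate : ∀ {A : Set} {n} (p : A → Bool) (f : Fin n → A) →
  length (filterᵇ p (tabulate f)) ≡ ∑[ i < n ] [ p (f i) ]
length-filterᵇ-tabulate {n = zero}  p f = refl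
length-filterᵇ-tabulate {n = suc n} p f with p (f zero)
... | true  = cong suc (length-filterᵇ-tabulate p (f ∘ suc))
... | false = length-filterᵇ-tabulate p (f ∘ suc)

module _ {n} (G : Graph n) where
  open Graph G

  degree≡∑ : ∀ x → degree G x ≡ ∑[ z < n ] [ adj x z ]
  degree≡∑ x = length-filterᵇ-tabulate (adj x) id

  common≡∑ : ∀ x y → common G x y ≡ ∑[ z < n ] ([ adj x z ] * [ adj y z ])
  common≡∑ x y = trans (length-filterᵇ-tabulate (λ z → adj x z ∧ adj y z) id)
                       (sum-cong-≗ (λ z → [∧]≡[]*[] (adj x z) (adj y z)))

  common-self : ∀ x → common G x x ≡ degree G x
  common-self x = trans (common≡∑ x x)
                        (trans (sum-cong-≗ (λ z → []*[]≡[] (adj x z))) (sym (degree≡∑ x)))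

  adjacent⇒≢ : ∀ {a b} → adj a b ≡ true → a ≢ b
  adjacent⇒≢ {a} a~b refl with trans (sym a~b) (irrefl a)
  ... | ()

VertexBound : ℕ → ℕ → ℕ → Set
VertexBound c b e = 2 * (c * b) + b + e ≤ 2 * c + b * b

n≤n*n : ∀ n → n ≤ n * n
n≤n*n zero      = z≤n
n≤n*n n@(suc _) = m≤m*n n n

3*n≤2+n*n : ∀ n → 3 * n ≤ 2 + n * n
3*n≤2+n*n 0 = z≤n
3*n≤2+n*n 1 = ≤-refl
3*n≤2+n*n 2 = ≤-refl
3*n≤2+n*n n@(suc (suc (suc _))) = ≤-trans (*-monoˡ-≤ n {3} {n} (s≤s (s≤s (s≤s z≤n)))) (m≤n+m (n * n) 2)

vertex-bound-at-x : ∀ m → VertexBound 0 m (m * (m ∸ 1))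
vertex-bound-at-x zero    = z≤n
vertex-bound-at-x (suc m) = ≤-reflexive (sym (*-suc (suc m) m))

vertex-bound-at-y : ∀ b → 2 ≤ b → VertexBound 0 b 2
vertex-bound-at-y b 2≤b = ≤-trans (+-mono-≤ (≤-refl {b}) 2≤b)
                                  (subst (_≤ b * b) (2*n≡n+n b) (*-monoˡ-≤ b 2≤b))
  where
  2*n≡n+n : ∀ n → 2 * n ≡ n + n
  2*n≡n+n = solve-∀

vertex-bound-in-S : VertexBound 1 0 2
vertex-bound-in-S = ≤-refl

vertex-bound-elsewhere : ∀ a b → VertexBound [ a ] b 0
vertex-bound-elsewhere false b = subst (_≤ b * b) (sym (+-identityʳ b)) (n≤n*n b)
vertex-bound-elsewhere true  b = subst (_≤ 2 + b * b) (3*n≡ b) (3*n≤2+n*n b)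
  where
  3*n≡ : ∀ n → 3 * n ≡ 2 * (1 * n) + n + 0
  3*n≡ = solve-∀

IndependentInLocal : ∀ {n m} → Graph n → Fin n → (Fin m → Fin n) → Set
IndependentInLocal G x S =
    (∀ i j → i ≢ j → S i ≢ S j)
  × (∀ i → Graph.adj G x (S i) ≡ true)
  × (∀ i j → ¬ Graph.adj G (S i) (S j) ≡ true)

module LocalIndependentSet
  {n m} (G : Graph n) {k λ₀ μ} (srg : IsSRG G k λ₀ μ)
  {x} {S : Fin m → Fin n} (independent : IndependentInLocal G x S)
  {y} (x≢y : x ≢ y) (x≁y : ¬ Graph.adj G x y ≡ true)
  {i j} (i≢j : i ≢ j) (Si~y : Graph.adj G (S i) y ≡ true) (Sj~y : Graph.adj G (S j) y ≡ true)
  where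

  open Graph G

  private
    S-injective : ∀ p q → p ≢ q → S p ≢ S q
    S-injective = proj₁ independent

    x~S : ∀ p → adj x (S p) ≡ true
    x~S = proj₁ (proj₂ independent)

    S≁S : ∀ p q → ¬ adj (S p) (S q) ≡ true
    S≁S = proj₂ (proj₂ independent)

    S~x : ∀ p → adj (S p) x ≡ true
    S~x p = trans (symm (S p) x) (x~S p)

    S≢x : ∀ p → S p ≢ x
    S≢x p = adjacent⇒≢ G (S~x p)

    S≢y : ∀ p → S p ≢ y
    S≢y p refl = x≁y (x~S p)

  Δx : Fin n → ℕ
  Δx z = [ adj x z ]

  hits : Fin n → ℕ
  hits z = ∑[ p < m ] [ adj (S p) z ]

  occurrences : Fin n → ℕ
  occurrences z = ∑[ p < m ] δ (S p) z

  -- the slack of the vertex bound at x, y and the members of S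
  excess : Fin n → ℕ
  excess z = 2 * (occurrences z + δ y z) + δ x z * (m * (m ∸ 1))

  Δx-x : Δx x ≡ 0
  Δx-x = cong [_] (irrefl x)

  Δx-y : Δx y ≡ 0
  Δx-y = []≡0 x≁y

  Δx-S : ∀ q → Δx (S q) ≡ 1
  Δx-S q = cong [_] (x~S q)

  hits-x : hits x ≡ m
  hits-x = trans (sum-cong-≗ (λ p → cong [_] (S~x p))) (trans (∑-const m 1) (*-identityʳ m))

  hits-S : ∀ q → hits (S q) ≡ 0
  hits-S q = trans (sum-cong-≗ (λ p → []≡0 (S≁S p q))) (trans (∑-const m 0) (*-zeroʳ m))

  2≤hits-y : 2 ≤ hits y
  2≤hits-y = subst (_≤ hits y) (cong₂ _+_ (cong [_] Si~y) (cong [_] Sj~y))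
                   (two-terms≤∑ (λ p → [ adj (S p) y ]) i≢j)

  occurrences-∉ : ∀ {z} → (∀ p → S p ≢ z) → occurrences z ≡ 0
  occurrences-∉ z∉S = trans (sum-cong-≗ (λ p → δ-≢ (z∉S p))) (trans (∑-const m 0) (*-zeroʳ m))

  occurrences-S : ∀ q → occurrences (S q) ≡ 1
  occurrences-S q = trans (sum-cong-≗ δ-S) (∑-δ q)
    where
    δ-S : ∀ p → δ (S p) (S q) ≡ δ q p
    δ-S p with p ≟ q
    ... | yes refl = trans (δ-refl (S p)) (sym (δ-refl p))
    ... | no p≢q   = trans (δ-≢ (S-injective p q p≢q)) (sym (δ-≢ (p≢q ∘ sym)))

  excess≡ : ∀ {z o d e} → occurrences z ≡ o → δ y z ≡ d → δ x z ≡ e →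
            excess z ≡ 2 * (o + d) + e * (m * (m ∸ 1))
  excess≡ refl refl refl = refl

  excess-x : excess x ≡ m * (m ∸ 1)
  excess-x = trans (excess≡ (occurrences-∉ S≢x) (δ-≢ (x≢y ∘ sym)) (δ-refl x)) (+-identityʳ _)

  excess-y : excess y ≡ 2
  excess-y = excess≡ (occurrences-∉ S≢y) (δ-refl y) (δ-≢ x≢y)

  excess-S : ∀ q → excess (S q) ≡ 2
  excess-S q = excess≡ (occurrences-S q) (δ-≢ (S≢y q ∘ sym)) (δ-≢ (S≢x q ∘ sym))

  excess-elsewhere : ∀ {z} → x ≢ z → y ≢ z → (∀ p → S p ≢ z) → excess z ≡ 0
  excess-elsewhere x≢z y≢z z∉S = excess≡ (occurrences-∉ z∉S) (δ-≢ y≢z) (δ-≢ x≢z)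

  vertex-bound-from : ∀ {z c b e} → Δx z ≡ c → hits z ≡ b → excess z ≡ e →
                      VertexBound c b e → VertexBound (Δx z) (hits z) (excess z)
  vertex-bound-from refl refl refl bound = bound

  data Location (z : Fin n) : Set where
    at-x      : x ≡ z → Location z
    at-y      : y ≡ z → Location z
    in-S      : ∀ q → S q ≡ z → Location z
    elsewhere : x ≢ z → y ≢ z → (∀ p → S p ≢ z) → Location z

  locate : ∀ z → Location z
  locate z with x ≟ z | y ≟ z | any? (λ p → S p ≟ z)
  ... | yes x≡z | _       | _              = at-x x≡z
  ... | no _    | yes y≡z | _              = at-y y≡z
  ... | no _    | no _    | yes (q , Sq≡z) = in-S q Sq≡z
  ... | no x≢z  | no y≢z  | no z∉S         = elsewhere x≢z y≢z (λ p Sp≡z → z∉S (p , Sp≡z))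

  vertex-bound : ∀ z → VertexBound (Δx z) (hits z) (excess z)
  vertex-bound z with locate z
  ... | at-x refl   = vertex-bound-from Δx-x hits-x excess-x (vertex-bound-at-x m)
  ... | at-y refl   = vertex-bound-from Δx-y refl excess-y (vertex-bound-at-y (hits y) 2≤hits-y)
  ... | in-S q refl = vertex-bound-from (Δx-S q) (hits-S q) (excess-S q) vertex-bound-in-S
  ... | elsewhere x≢z y≢z z∉S =
    vertex-bound-from refl refl (excess-elsewhere x≢z y≢z z∉S) (vertex-bound-elsewhere (adj x z) (hits z))

  ∑Δx : ∑[ z < n ] Δx z ≡ k
  ∑Δx = trans (sym (degree≡∑ G x)) (proj₁ srg x)

  ∑hits : ∑[ z < n ] hits z ≡ m * k
  ∑hits = begin
    ∑[ z < n ] ∑[ p < m ] [ adj (S p) z ]  ≡⟨ ∑-comm (λ p z → [ adj (S p) z ]) ⟨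
    ∑[ p < m ] ∑[ z < n ] [ adj (S p) z ]  ≡⟨ sum-cong-≗ (λ p → trans (sym (degree≡∑ G (S p))) (proj₁ srg (S p))) ⟩
    ∑[ p < m ] k                           ≡⟨ ∑-const m k ⟩
    m * k                                  ∎
    where open ≡-Reasoning

  ∑Δx*hits : ∑[ z < n ] (Δx z * hits z) ≡ m * λ₀
  ∑Δx*hits = begin
    ∑[ z < n ] (Δx z * hits z)                         ≡⟨ sum-cong-≗ distribute ⟩
    ∑[ z < n ] ∑[ p < m ] (Δx z * [ adj (S p) z ])     ≡⟨ ∑-comm (λ p z → Δx z * [ adj (S p) z ]) ⟨
    ∑[ p < m ] ∑[ z < n ] (Δx z * [ adj (S p) z ])     ≡⟨ sum-cong-≗ common-x-S ⟩
    ∑[ p < m ] λ₀                                      ≡⟨ ∑-const m λ₀ ⟩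
    m * λ₀                                             ∎
    where
    open ≡-Reasoning
    distribute : ∀ z → Δx z * hits z ≡ ∑[ p < m ] (Δx z * [ adj (S p) z ])
    distribute z = *-distribˡ-sum (Δx z) (λ p → [ adj (S p) z ])

    common-x-S : ∀ p → ∑[ z < n ] (Δx z * [ adj (S p) z ]) ≡ λ₀
    common-x-S p = trans (sym (common≡∑ G x (S p)))
                         (proj₁ (proj₂ srg) x (S p) (S≢x p ∘ sym) (x~S p))

  ∑hits*hits : ∑[ z < n ] (hits z * hits z) ≡ m * (k + (m ∸ 1) * μ)
  ∑hits*hits = begin
    ∑[ z < n ] (hits z * hits z)                       ≡⟨ sum-cong-≗ square ⟩
    ∑[ z < n ] ∑[ p < m ] ∑[ q < m ] a p q z           ≡⟨ ∑-comm (λ p z → ∑[ q < m ] a p q z) ⟨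
    ∑[ p < m ] ∑[ z < n ] ∑[ q < m ] a p q z           ≡⟨ sum-cong-≗ (λ p → sym (∑-comm (a p))) ⟩
    ∑[ p < m ] ∑[ q < m ] ∑[ z < n ] a p q z           ≡⟨ sum-cong-≗ row ⟩
    ∑[ p < m ] (k + (m ∸ 1) * μ)                       ≡⟨ ∑-const m _ ⟩
    m * (k + (m ∸ 1) * μ)                              ∎
    where
    open ≡-Reasoning
    a : Fin m → Fin m → Fin n → ℕ
    a p q z = [ adj (S p) z ] * [ adj (S q) z ]


    square : ∀ z → hits z * hits z ≡ ∑[ p < m ] ∑[ q < m ] a p q z
    square z = trans (*-distribʳ-sum (hits z) (λ p → [ adj (S p) z ]))
                     (sum-cong-≗ (λ p → *-distribˡ-sum [ adj (S p) z ] (λ q → [ adj (S q) z ])))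

    row : ∀ p → ∑[ q < m ] ∑[ z < n ] a p q z ≡ k + (m ∸ 1) * μ
    row p = trans (∑-except (λ q → ∑[ z < n ] a p q z) p off-diagonal)
                  (cong (_+ (m ∸ 1) * μ) diagonal)
      where
      diagonal : ∑[ z < n ] a p p z ≡ k
      diagonal = trans (sym (common≡∑ G (S p) (S p))) (trans (common-self G (S p)) (proj₁ srg (S p)))

      off-diagonal : ∀ q → q ≢ p → ∑[ z < n ] a p q z ≡ μ
      off-diagonal q q≢p = trans (sym (common≡∑ G (S p) (S q)))
                                 (proj₂ (proj₂ srg) (S p) (S q) (S-injective p q (q≢p ∘ sym)) (S≁S p q))

  ∑excess : ∑[ z < n ] excess z ≡ 2 * (m + 1) + m * (m ∸ 1)
  ∑excess = begin
    ∑[ z < n ] excess z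
      ≡⟨ ∑-distrib-+ (λ z → 2 * (occurrences z + δ y z)) (λ z → δ x z * (m * (m ∸ 1))) ⟩
    ∑[ z < n ] (2 * (occurrences z + δ y z)) + ∑[ z < n ] (δ x z * (m * (m ∸ 1)))
      ≡⟨ cong₂ _+_ (sym (*-distribˡ-sum 2 (λ z → occurrences z + δ y z))) (sym (*-distribʳ-sum (m * (m ∸ 1)) (δ x))) ⟩
    2 * ∑[ z < n ] (occurrences z + δ y z) + ∑[ z < n ] δ x z * (m * (m ∸ 1))
      ≡⟨ cong₂ (λ s t → 2 * s + t * (m * (m ∸ 1))) (∑-distrib-+ occurrences (δ y)) (∑-δ x) ⟩
    2 * (∑[ z < n ] occurrences z + ∑[ z < n ] δ y z) + 1 * (m * (m ∸ 1))
      ≡⟨ cong₂ (λ s t → 2 * (s + t) + 1 * (m * (m ∸ 1))) ∑occurrences (∑-δ y) ⟩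
    2 * (m + 1) + 1 * (m * (m ∸ 1))
      ≡⟨ cong (2 * (m + 1) +_) (*-identityˡ _) ⟩
    2 * (m + 1) + m * (m ∸ 1)
      ∎
    where
    open ≡-Reasoning
    ∑occurrences : ∑[ z < n ] occurrences z ≡ m
    ∑occurrences = begin
      ∑[ z < n ] ∑[ p < m ] δ (S p) z  ≡⟨ ∑-comm (λ p z → δ (S p) z) ⟨
      ∑[ p < m ] ∑[ z < n ] δ (S p) z  ≡⟨ sum-cong-≗ (∑-δ ∘ S) ⟩
      ∑[ p < m ] 1                     ≡⟨ ∑-const m 1 ⟩
      m * 1                            ≡⟨ *-identityʳ m ⟩
      m                                ∎

  counting-bound : 2 * (m * λ₀) + (2 * (m + 1) + m * (m ∸ 1)) ≤ 2 * k + m * (m ∸ 1) * μ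
  counting-bound = +-cancelˡ-≤ (m * k) _ _ (begin
    m * k + (2 * (m * λ₀) + E)
      ≡⟨ move-middle (m * k) (2 * (m * λ₀)) E ⟩
    2 * (m * λ₀) + m * k + E
      ≡⟨ cong₂ _+_ (cong₂ _+_ (cong (2 *_) ∑Δx*hits) ∑hits) ∑excess ⟨
    2 * ∑[ z < n ] (Δx z * hits z) + ∑[ z < n ] hits z + ∑[ z < n ] excess z
      ≡⟨ cong (_+ ∑[ z < n ] excess z) (cong (_+ ∑[ z < n ] hits z) (*-distribˡ-sum 2 (λ z → Δx z * hits z))) ⟩
    ∑[ z < n ] (2 * (Δx z * hits z)) + ∑[ z < n ] hits z + ∑[ z < n ] excess z
      ≡⟨ cong (_+ ∑[ z < n ] excess z) (∑-distrib-+ (λ z → 2 * (Δx z * hits z)) hits) ⟨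
    ∑[ z < n ] (2 * (Δx z * hits z) + hits z) + ∑[ z < n ] excess z
      ≡⟨ ∑-distrib-+ (λ z → 2 * (Δx z * hits z) + hits z) excess ⟨
    ∑[ z < n ] (2 * (Δx z * hits z) + hits z + excess z)
      ≤⟨ ∑-mono-≤ vertex-bound ⟩
    ∑[ z < n ] (2 * Δx z + hits z * hits z)
      ≡⟨ ∑-distrib-+ (λ z → 2 * Δx z) (λ z → hits z * hits z) ⟩
    ∑[ z < n ] (2 * Δx z) + ∑[ z < n ] (hits z * hits z)
      ≡⟨ cong₂ _+_ (trans (sym (*-distribˡ-sum 2 Δx)) (cong (2 *_) ∑Δx)) ∑hits*hits ⟩
    2 * k + m * (k + (m ∸ 1) * μ)
      ≡⟨ expand m k (m ∸ 1) μ ⟩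
    m * k + (2 * k + m * (m ∸ 1) * μ)
      ∎)
    where
    open ≤-Reasoning
    E : ℕ
    E = 2 * (m + 1) + m * (m ∸ 1)

    move-middle : ∀ a b c → a + (b + c) ≡ b + a + c
    move-middle = solve-∀

    expand : ∀ m k t μ → 2 * k + m * (k + t * μ) ≡ m * k + (2 * k + m * t * μ)
    expand = solve-∀

lemma4p2 : (G : Graph 1911) → IsSRG G 270 105 27 →
    (x u y v : Fin 1911) → InducedQuadrangle G x u y v →
    ¬ (∃[ S ] (IndependentInLocal5 G x S × (∃[ i ] S i ≡ u) × (∃[ j ] S j ≡ v)))
lemma4p2 G srg x u y v (_ , x≢y , _ , _ , u≢v , _ , _ , u~y , y~v , _ , x≁y , _)
         (S , independent , (i , Si≡u) , (j , Sj≡v)) =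
  from-no (1082 ≤? 1080)
    (LocalIndependentSet.counting-bound G srg independent x≢y x≁y i≢j Si~y Sj~y)
  where
  open Graph G
  i≢j : i ≢ j
  i≢j i≡j = u≢v (trans (sym Si≡u) (trans (cong S i≡j) Sj≡v))

  Si~y : adj (S i) y ≡ true
  Si~y = subst (λ w → adj w y ≡ true) (sym Si≡u) u~y

  Sj~y : adj (S j) y ≡ true
  Sj~y = subst (λ w → adj w y ≡ true) (sym Sj≡v) (trans (symm v y) y~v)
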